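{- For any $\tau\in\mathfrak S_n$, letting $\sigma=\Phi^{ -1}(\tau)$, $$B(\tau)=[14,23](\tau)-M(\tau),$$ where $B(\tau)$ is the number of pairs of positions $i<j$ with $\tau_i<\tau_j<\tau_{j+1}<\sigma(\tau_i)$; $[14,23](\tau)$ is the number of pairs of positions $i,j$ with $i+1<j$ and $\tau_i<\tau_j<\tau_{j+1}<\tau_{i+1}$; and $M(\tau)$ is the number of such pairs $i,j$ (with $i+1<j$ and $\tau_i<\tau_j<\tau_{j+1}<\tau_{i+1}$) for which additionally there is no position $p<i$ with $\tau_p>\tau_{j+1}$.
   Context: The fundamental bijection $\Phi$: for $\sigma\in\mathfrak S_n$, write $\sigma$ in cycle notation with each cycle beginning with its largest element and cycles ordered by increasing largest element; erasing parentheses gives the one-line notation of $\Phi(\sigma)$. $\Phi$ is a bijection $\mathfrak S_n\to\mathfrak S_n$. -}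

module Defs where

open import Data.Nat as ℕ using (ℕ; zero; suc; _<_; _≤_; _<?_; _≤?_)
open import Data.Fin as Fin using (Fin; toℕ)
open import Data.Fin.Permutation using (Permutation′; _⟨$⟩ʳ_)
open import Data.List using (List; []; _∷_; filter; concatMap; allFin; length; upTo; cartesianProduct; map)
open import Data.List.Relation.Unary.All using (All; all?)
open import Data.Product using (_×_; _,_)
open import Relation.Nullary using (¬_; yes; no)
open import Relation.Nullary.Decidable using (_×-dec_)

-- Permutations of [n] are permutations of Fin n (values/positions 0-based;
-- only relative order matters for all statistics below).

-- walk σ m f x : the list x, σ x, σ² x, ... stopping just before reaching m
-- (fuel f; fuel n suffices since cycles have length ≤ n).
walk : ∀ {n} → (Fin n → Fin n) → Fin n → ℕ → Fin n → List (Fin n)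
walk σ m zero    x = []
walk σ m (suc f) x with x Fin.≟ m
... | yes _ = []
... | no  _ = x ∷ walk σ m f (σ x)

cycleOf : ∀ {n} → Permutation′ n → Fin n → List (Fin n)
cycleOf {n} σ m = m ∷ walk (σ ⟨$⟩ʳ_) m n (σ ⟨$⟩ʳ m)

IsCycleMax : ∀ {n} → Permutation′ n → Fin n → Set
IsCycleMax σ m = All (λ x → x Fin.≤ m) (cycleOf σ m)

-- The fundamental bijection Φ: cycles each begin with their largest element,
-- ordered by increasing largest element; erase parentheses.  Result is the
-- one-line notation of Φ(σ), as a list.
Φ : ∀ {n} → Permutation′ n → List (Fin n)
Φ {n} σ = concatMap (cycleOf σ)
            (filter (λ m → all? (λ x → x Fin.≤? m) (cycleOf σ m)) (allFin n))

oneLine : ∀ {n} → Permutation′ n → List (Fin n)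
oneLine {n} τ = map (τ ⟨$⟩ʳ_) (allFin n)

-- Lift a function on Fin n to ℕ → ℕ (value 0 outside [0,n); only used on
-- arguments < n).
lift : ∀ {n} → (Fin n → Fin n) → ℕ → ℕ
lift {n} f k with k <? n
... | yes k<n = toℕ (f (Fin.fromℕ< k<n))
... | no  _   = 0

countPairs : (n : ℕ) → (P : ℕ × ℕ → Set) →
             ((x : ℕ × ℕ) → Relation.Nullary.Dec (P x)) → ℕ
countPairs n P P? = length (filter P? (cartesianProduct (upTo n) (upTo n)))

module _ {n : ℕ} (τ : Permutation′ n) where
  private
    t : ℕ → ℕ
    t = lift (τ ⟨$⟩ʳ_)

  BPred : Permutation′ n → ℕ × ℕ → Set
  BPred σ (i , j) = i < j × suc j < n × t i < t j × t j < t (suc j)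
                    × t (suc j) < lift (σ ⟨$⟩ʳ_) (t i)

  B : Permutation′ n → ℕ
  B σ = countPairs n (BPred σ) λ { (i , j) →
          (i <? j) ×-dec (suc j <? n) ×-dec (t i <? t j) ×-dec (t j <? t (suc j))
          ×-dec (t (suc j) <? lift (σ ⟨$⟩ʳ_) (t i)) }

  P1423 : ℕ × ℕ → Set
  P1423 (i , j) = suc i < j × suc j < n × t i < t j × t j < t (suc j)
                  × t (suc j) < t (suc i)

  P1423? : (x : ℕ × ℕ) → Relation.Nullary.Dec (P1423 x)
  P1423? (i , j) = (suc i <? j) ×-dec (suc j <? n) ×-dec (t i <? t j)
                   ×-dec (t j <? t (suc j)) ×-dec (t (suc j) <? t (suc i))

  c1423 : ℕ
  c1423 = countPairs n P1423 P1423?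

  MPred : ℕ × ℕ → Set
  MPred (i , j) = P1423 (i , j) × All (λ p → t p ≤ t (suc j)) (upTo i)

  M : ℕ
  M = countPairs n MPred λ { (i , j) →
        P1423? (i , j) ×-dec all? (λ p → t p ≤? t (suc j)) (upTo i) }

-- Reading the cycles of σ off τ = Φ(σ) shows σ(τᵢ) = min(τᵢ₊₁, max(τ₀, …, τᵢ)): inside a
-- cycle the next letter lies below the current cycle maximum, which is the running maximum
-- because cycle maxima increase; at the end of a cycle τᵢ returns to that maximum, and the
-- next letter, a new cycle maximum, exceeds it.  So for i < j with τⱼ < τⱼ₊₁, the condition
-- τⱼ₊₁ < σ(τᵢ) of B means τⱼ₊₁ < τᵢ₊₁ (which forces j > i + 1, making (i, j) a [14,23]
-- pair) together with τⱼ₊₁ < max(τ₀, …, τᵢ), which is exactly failing the extra condition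
-- of M.  Hence [14,23](τ) = M(τ) + B(τ).
module Submission where

open import Defs
open import Data.Nat using (ℕ)
open import Data.Integer using (ℤ; +_; _-_)
open import Data.List using (List)
open import Data.Fin.Permutation using (Permutation′)
open import Relation.Binary.PropositionalEquality using (_≡_)

open import Data.Nat using (zero; suc; _<_; _≤_; _⊔_; _⊓_; _+_; _∸_; _<?_; _≤?_; z≤n; s≤s; s≤s⁻¹)
open import Data.Nat.Properties
open import Data.Integer using (_⊖_)
open import Data.Fin as Fin using (Fin; toℕ)
import Data.Fin.Properties as Finₚ
open import Data.Fin.Permutation using (_⟨$⟩ʳ_)
open import Data.List using ([]; _∷_; _++_; map; length; filter; concatMap; allFin; upTo; tabulate; cartesianProduct)
import Data.List.Properties as Listₚ
open import Data.List.Properties using (filter-≐)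
open import Data.List.Relation.Unary.All using (All; []; _∷_; all?)
import Data.List.Relation.Unary.All.Properties as Allₚ
open import Data.List.Relation.Unary.AllPairs using (AllPairs; []; _∷_)
import Data.List.Relation.Unary.AllPairs.Properties as AllPairsₚ
open import Data.Product using (_×_; _,_; proj₁; proj₂; swap)
open import Data.Sum using (inj₁; inj₂)
open import Data.Unit using (⊤; tt)
open import Data.Empty using (⊥-elim)
open import Function using (_∘_)
open import Level using (0ℓ)
open import Relation.Nullary using (yes; no)
open import Relation.Unary using (Pred; Decidable; _≐_; _∩_; ∁)
open import Relation.Unary.Properties using (_∩?_; ∁?)
open import Relation.Binary.PropositionalEquality using (refl; sym; trans; cong; cong₂; subst; module ≡-Reasoning)
import Data.Integer.Properties as ℤₚ

prefixMax : (ℕ → ℕ) → ℕ → ℕ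
prefixMax t zero    = t zero
prefixMax t (suc i) = prefixMax t i ⊔ t (suc i)

≤-prefixMax : ∀ t {p i} → p ≤ i → t p ≤ prefixMax t i
≤-prefixMax t {i = zero}  z≤n = ≤-refl
≤-prefixMax t {i = suc i} p≤1+i with m≤n⇒m<n∨m≡n p≤1+i
... | inj₁ p<1+i = ≤-trans (≤-prefixMax t (s≤s⁻¹ p<1+i)) (m≤m⊔n _ _)
... | inj₂ refl  = m≤n⊔m _ _

prefixMax-lub : ∀ t i {y} → (∀ {p} → p ≤ i → t p ≤ y) → prefixMax t i ≤ y
prefixMax-lub t zero    t≤y = t≤y z≤n
prefixMax-lub t (suc i) t≤y = ⊔-lub (prefixMax-lub t i (t≤y ∘ m≤n⇒m≤1+n)) (t≤y ≤-refl)

prefixMax≤⇒All≤ : ∀ t i {y} → prefixMax t i ≤ y → All (λ p → t p ≤ y) (upTo i)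
prefixMax≤⇒All≤ t i pm≤y = Allₚ.applyUpTo⁺₁ (λ p → p) i (λ p<i → ≤-trans (≤-prefixMax t (<⇒≤ p<i)) pm≤y)

All≤⇒prefixMax≤ : ∀ t i {y} → t i ≤ y → All (λ p → t p ≤ y) (upTo i) → prefixMax t i ≤ y
All≤⇒prefixMax≤ t i {y} tᵢ≤y all≤y = prefixMax-lub t i below
  where
  below : ∀ {p} → p ≤ i → t p ≤ y
  below p≤i with m≤n⇒m<n∨m≡n p≤i
  ... | inj₁ p<i = Allₚ.applyUpTo⁻ (λ p → p) i all≤y p<i
  ... | inj₂ refl = tᵢ≤y

SuccessorAt : (t s : ℕ → ℕ) → ℕ → Set
SuccessorAt t s i = s (t i) ≡ t (suc i) ⊓ prefixMax t i

-- The rule of SuccessorAt along the letters V that follow x, with h the maximum up to x.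
SuccessorRule : (s : ℕ → ℕ) (h x : ℕ) → List ℕ → Set
SuccessorRule s h x []      = ⊤
SuccessorRule s h x (y ∷ V) = s x ≡ y ⊓ h × SuccessorRule s (h ⊔ y) y V

ReadsFrom : (ℕ → ℕ) → ℕ → List ℕ → Set
ReadsFrom t k []       = ⊤
ReadsFrom t k (x ∷ xs) = t k ≡ x × ReadsFrom t (suc k) xs

readsFrom-tabulate : ∀ {m} t k (g : Fin m → ℕ) → (∀ i → t (k + toℕ i) ≡ g i) →
                     ReadsFrom t k (tabulate g)
readsFrom-tabulate {zero}  t k g t≡g = tt
readsFrom-tabulate {suc m} t k g t≡g =
  trans (cong t (sym (+-identityʳ k))) (t≡g Fin.zero) ,
  readsFrom-tabulate t (suc k) (g ∘ Fin.suc)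
    (λ i → trans (cong t (sym (+-suc k (toℕ i)))) (t≡g (Fin.suc i)))

successorRule⇒successorAt : ∀ {t s h x} V k → SuccessorRule s h x V → ReadsFrom t k (x ∷ V) →
                            prefixMax t k ≡ h → ∀ i → i < length V → SuccessorAt t s (i + k)
successorRule⇒successorAt (y ∷ V) k (sx≡y⊓h , _) (tₖ≡x , tₖ₊₁≡y , _) pmₖ≡h zero _
  rewrite tₖ≡x | tₖ₊₁≡y | pmₖ≡h = sx≡y⊓h
successorRule⇒successorAt {t} {s} (y ∷ V) k (_ , rule) (_ , reads@(tₖ₊₁≡y , _)) pmₖ≡h
                          (suc i) (s≤s i<len) =
  subst (SuccessorAt t s) (+-suc i k)
    (successorRule⇒successorAt V (suc k) rule reads (cong₂ _⊔_ pmₖ≡h tₖ₊₁≡y) i i<len)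

OrbitTo : (s : ℕ → ℕ) (h x : ℕ) → List ℕ → Set
OrbitTo s h x []      = s x ≡ h
OrbitTo s h x (y ∷ w) = s x ≡ y × y < h × OrbitTo s h y w

orbitTo-++ : ∀ {s h x} w V → OrbitTo s h x w → (∀ {z} → s z ≡ h → SuccessorRule s h z V) →
             SuccessorRule s h x (w ++ V)
orbitTo-++ []      V sx≡h         rest = rest sx≡h
orbitTo-++ {s} {h} (y ∷ w) V (sx≡y , y<h , orbit) rest =
  trans sx≡y (sym (m≤n⇒m⊓n≡m (<⇒≤ y<h))) ,
  subst (λ h′ → SuccessorRule s h′ y (w ++ V)) (sym (m≥n⇒m⊔n≡m (<⇒≤ y<h)))
        (orbitTo-++ w V orbit rest)

lift-toℕ : ∀ {n} (f : Fin n → Fin n) (q : Fin n) → lift f (toℕ q) ≡ toℕ (f q)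
lift-toℕ {n} f q with toℕ q <? n
... | yes q<n = cong (toℕ ∘ f) (Finₚ.fromℕ<-toℕ q q<n)
... | no  q≮n = ⊥-elim (q≮n (Finₚ.toℕ<n q))

module _ {n : ℕ} (σ : Permutation′ n) where
  private
    σ′ : Fin n → Fin n
    σ′ = σ ⟨$⟩ʳ_

    s : ℕ → ℕ
    s = lift σ′

    word : List (Fin n) → List (Fin n)
    word = concatMap (cycleOf σ)

  -- A walk shorter than its fuel has stopped because it reached m.
  walk-orbitTo : ∀ m f p → length (walk σ′ m f (σ′ p)) < f → All (Fin._≤ m) (walk σ′ m f (σ′ p)) →
                 OrbitTo s (toℕ m) (toℕ p) (map toℕ (walk σ′ m f (σ′ p)))
  walk-orbitTo m (suc f) p len<f below with σ′ p Fin.≟ m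
  ... | yes σp≡m = trans (lift-toℕ σ′ p) (cong toℕ σp≡m)
  ... | no  σp≢m with below
  ...   | σp≤m ∷ below′ =
    lift-toℕ σ′ p , Finₚ.≤∧≢⇒< σp≤m σp≢m , walk-orbitTo m f (σ′ p) (s≤s⁻¹ len<f) below′

  private
    split-length : ∀ m Hs → length (word (m ∷ Hs)) ≤ n →
                   length (walk σ′ m n (σ′ m)) < n × length (word Hs) ≤ n
    split-length m Hs len≤n =
      m+n≤o⇒m≤o (suc (length orbit)) bound , m+n≤o⇒n≤o (suc (length orbit)) bound
      where
      orbit = walk σ′ m n (σ′ m)
      bound : suc (length orbit + length (word Hs)) ≤ n
      bound = subst (λ l → suc l ≤ n) (Listₚ.length-++ orbit) len≤n

  -- Each walk has fuel n, so it runs to the end of its cycle as the whole word has length n.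
  mutual
    cyclesRule : ∀ Hs h → AllPairs Fin._<_ Hs → All (λ m → h < toℕ m) Hs → All (IsCycleMax σ) Hs →
                 length (word Hs) ≤ n → ∀ {z} → s z ≡ h → SuccessorRule s h z (map toℕ (word Hs))
    cyclesRule []       h _              _            _     _     _    = tt
    cyclesRule (m ∷ Hs) h (m<Hs ∷ sorted) (h<m ∷ h<Hs) isMax len≤n sz≡h =
      trans sz≡h (sym (m≥n⇒m⊓n≡n (<⇒≤ h<m))) ,
      subst (λ h′ → SuccessorRule s h′ (toℕ m) (map toℕ (walk σ′ m n (σ′ m) ++ word Hs)))
            (sym (m≤n⇒m⊔n≡n (<⇒≤ h<m))) (cycleRule m Hs m<Hs sorted isMax len≤n)

    cycleRule : ∀ m Hs → All (m Fin.<_) Hs → AllPairs Fin._<_ Hs → All (IsCycleMax σ) (m ∷ Hs) →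
                length (word (m ∷ Hs)) ≤ n →
                SuccessorRule s (toℕ m) (toℕ m) (map toℕ (walk σ′ m n (σ′ m) ++ word Hs))
    cycleRule m Hs m<Hs sorted ((_ ∷ orbit≤m) ∷ isMax) len≤n
      rewrite Listₚ.map-++ toℕ (walk σ′ m n (σ′ m)) (word Hs) =
      orbitTo-++ (map toℕ (walk σ′ m n (σ′ m))) (map toℕ (word Hs))
        (walk-orbitTo m n m (proj₁ (split-length m Hs len≤n)) orbit≤m)
        (cyclesRule Hs (toℕ m) sorted m<Hs isMax (proj₂ (split-length m Hs len≤n)))

  Φ-successorAt : (t : ℕ → ℕ) → length (Φ σ) ≡ n → ReadsFrom t 0 (map toℕ (Φ σ)) →
                  ∀ i → suc i < n → SuccessorAt t s i
  Φ-successorAt t len≡n reads = go cycleMaxima sorted isMax len≡n reads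
    where
    cycleMaxima : List (Fin n)
    cycleMaxima = filter (λ m → all? (λ x → x Fin.≤? m) (cycleOf σ m)) (allFin n)

    sorted : AllPairs Fin._<_ cycleMaxima
    sorted = AllPairsₚ.filter⁺ _ (AllPairsₚ.tabulate⁺-< (λ lt → lt))

    isMax : All (IsCycleMax σ) cycleMaxima
    isMax = Allₚ.all-filter _ (allFin n)

    go : ∀ Hs → AllPairs Fin._<_ Hs → All (IsCycleMax σ) Hs → length (word Hs) ≡ n →
         ReadsFrom t 0 (map toℕ (word Hs)) → ∀ i → suc i < n → SuccessorAt t s i
    go [] _ _ len≡n _ i i+1<n = ⊥-elim (n≮0 (subst (suc i <_) (sym len≡n) i+1<n))
    go (m ∷ Hs) (m<Hs ∷ sorted′) isMax′ len≡n (t₀≡m , reads′) i i+1<n =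
      subst (SuccessorAt t s) (+-identityʳ i)
        (successorRule⇒successorAt V 0 (cycleRule m Hs m<Hs sorted′ isMax′ (≤-reflexive len≡n))
           (t₀≡m , reads′) t₀≡m i (s≤s⁻¹ (subst (suc i <_) (sym len-V) i+1<n)))
      where
      V = map toℕ (walk σ′ m n (σ′ m) ++ word Hs)
      len-V : suc (length V) ≡ n
      len-V = trans (Listₚ.length-map toℕ (word (m ∷ Hs))) len≡n

module _ {n : ℕ} (τ : Permutation′ n) where
  private
    τ′ : Fin n → Fin n
    τ′ = τ ⟨$⟩ʳ_

  length-oneLine : length (oneLine τ) ≡ n
  length-oneLine = trans (Listₚ.length-map τ′ (allFin n)) (Listₚ.length-tabulate (λ i → i))

  readsFrom-oneLine : ReadsFrom (lift τ′) 0 (map toℕ (oneLine τ))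
  readsFrom-oneLine =
    subst (ReadsFrom (lift τ′) 0)
      (sym (trans (cong (map toℕ) (Listₚ.map-tabulate (λ i → i) τ′)) (Listₚ.map-tabulate τ′ toℕ)))
      (readsFrom-tabulate (lift τ′) 0 (toℕ ∘ τ′) (lift-toℕ τ′))

Φ-successor : ∀ {n} (τ σ : Permutation′ n) → Φ σ ≡ oneLine τ →
              ∀ i → suc i < n → SuccessorAt (lift (τ ⟨$⟩ʳ_)) (lift (σ ⟨$⟩ʳ_)) i
Φ-successor τ σ Φσ≡τ = Φ-successorAt σ (lift (τ ⟨$⟩ʳ_))
  (trans (cong length Φσ≡τ) (length-oneLine τ))
  (subst (ReadsFrom (lift (τ ⟨$⟩ʳ_)) 0 ∘ map toℕ) (sym Φσ≡τ) (readsFrom-oneLine τ))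

module _ {A : Set} {P Q : Pred A 0ℓ} (P? : Decidable P) (Q? : Decidable Q) where

  length-filter-∩-∁ : ∀ xs → length (filter P? xs) ≡
                      length (filter (P? ∩? Q?) xs) + length (filter (P? ∩? ∁? Q?) xs)
  length-filter-∩-∁ []       = refl
  length-filter-∩-∁ (x ∷ xs) with P? x | Q? x
  ... | yes _ | yes _ = cong suc (length-filter-∩-∁ xs)
  ... | yes _ | no  _ = trans (cong suc (length-filter-∩-∁ xs)) (sym (+-suc _ _))
  ... | no  _ | _     = length-filter-∩-∁ xs

module _ {n : ℕ} (τ σ : Permutation′ n) (Φσ≡τ : Φ σ ≡ oneLine τ) where
  private
    t s : ℕ → ℕ
    t = lift (τ ⟨$⟩ʳ_)
    s = lift (σ ⟨$⟩ʳ_)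

  NoEarlierPeak : Pred (ℕ × ℕ) 0ℓ
  NoEarlierPeak (i , j) = All (λ p → t p ≤ t (suc j)) (upTo i)

  noEarlierPeak? : Decidable NoEarlierPeak
  noEarlierPeak? (i , j) = all? (λ p → t p ≤? t (suc j)) (upTo i)

  <-successor⇔ : ∀ {i y} → suc i < n → (y < s (t i) → y < t (suc i) × y < prefixMax t i) ×
                                        (y < t (suc i) → y < prefixMax t i → y < s (t i))
  <-successor⇔ {i} i+1<n rewrite Φ-successor τ σ Φσ≡τ i i+1<n =
    (λ y<min → m<n⊓o⇒m<n _ _ y<min , m<n⊓o⇒m<o _ _ y<min) , ⊓-glb

  BPred≐P1423∩∁NoEarlierPeak : BPred τ σ ≐ (P1423 τ ∩ ∁ NoEarlierPeak)
  BPred≐P1423∩∁NoEarlierPeak = toP1423 , fromP1423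
    where
    toP1423 : ∀ {x} → BPred τ σ x → (P1423 τ ∩ ∁ NoEarlierPeak) x
    toP1423 {i , j} (i<j , j+1<n , tᵢ<tⱼ , tⱼ<tⱼ₊₁ , tⱼ₊₁<stᵢ) =
      (i+1<j , j+1<n , tᵢ<tⱼ , tⱼ<tⱼ₊₁ , tⱼ₊₁<tᵢ₊₁) ,
      λ noPeak → <⇒≱ tⱼ₊₁<pmᵢ (All≤⇒prefixMax≤ t i (<⇒≤ (<-trans tᵢ<tⱼ tⱼ<tⱼ₊₁)) noPeak)
      where
      bounds = proj₁ (<-successor⇔ (≤-trans (s≤s i<j) (<⇒≤ j+1<n))) tⱼ₊₁<stᵢ
      tⱼ₊₁<tᵢ₊₁ = proj₁ bounds
      tⱼ₊₁<pmᵢ = proj₂ bounds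
      i+1<j : suc i < j
      i+1<j with m≤n⇒m<n∨m≡n i<j
      ... | inj₁ i+1<j = i+1<j
      ... | inj₂ refl  = ⊥-elim (<-asym tⱼ<tⱼ₊₁ tⱼ₊₁<tᵢ₊₁)

    fromP1423 : ∀ {x} → (P1423 τ ∩ ∁ NoEarlierPeak) x → BPred τ σ x
    fromP1423 {i , j} ((i+1<j , j+1<n , tᵢ<tⱼ , tⱼ<tⱼ₊₁ , tⱼ₊₁<tᵢ₊₁) , earlierPeak) =
      i<j , j+1<n , tᵢ<tⱼ , tⱼ<tⱼ₊₁ ,
      proj₂ (<-successor⇔ (≤-trans (s≤s i<j) (<⇒≤ j+1<n))) tⱼ₊₁<tᵢ₊₁
        (≰⇒> (λ pmᵢ≤tⱼ₊₁ → earlierPeak (prefixMax≤⇒All≤ t i pmᵢ≤tⱼ₊₁)))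
      where
      i<j = <-trans (n<1+n i) i+1<j

  c1423≡M+B : c1423 τ ≡ M τ + B τ σ
  c1423≡M+B = trans (length-filter-∩-∁ (P1423? τ) noEarlierPeak? pairs)
    (cong₂ _+_ (cong length (filter-≐ _ _ ((λ x → x) , (λ x → x)) pairs))
               (cong length (filter-≐ _ _ (swap BPred≐P1423∩∁NoEarlierPeak) pairs)))
    where
    pairs = cartesianProduct (upTo n) (upTo n)

[+m+n]-[+m]≡[+n] : ∀ m n → + (m + n) - + m ≡ + n
[+m+n]-[+m]≡[+n] m n = begin
  + (m + n) - + m  ≡⟨ ℤₚ.[+m]-[+n]≡m⊖n (m + n) m ⟩
  (m + n) ⊖ m      ≡⟨ ℤₚ.⊖-≥ (m≤m+n m n) ⟩
  + (m + n ∸ m)    ≡⟨ cong +_ (m+n∸m≡n m n) ⟩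
  + n              ∎
  where open ≡-Reasoning

proposition4p8 : (n : ℕ) (τ σ : Permutation′ n) → Φ σ ≡ oneLine τ →
    + B τ σ ≡ + c1423 τ - + M τ
proposition4p8 n τ σ Φσ≡τ = begin
  + B τ σ                  ≡⟨ [+m+n]-[+m]≡[+n] (M τ) (B τ σ) ⟨
  + (M τ + B τ σ) - + M τ  ≡⟨ cong (λ c → + c - + M τ) (c1423≡M+B τ σ Φσ≡τ) ⟨
  + c1423 τ - + M τ        ∎
  where open ≡-Reasoning
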